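{- Let $G$ be a $3$-edge-connected multigraph with DFS tree $\mathcal{T}$ and hashing function $H$ as defined below. If $\{e,f,g\}$ is a $3$-edge-cut of $G$, then $H(g)=H(e)\oplus H(f)$, and $g$ is the unique edge of $G$ whose hash equals $H(e)\oplus H(f)$.
   Context: $G$ is $3$-edge-connected if it is connected and remains connected after removing any set of at most $2$ edges; a $3$-edge-cut is a set of $3$ edges whose removal disconnects $G$. A DFS tree $\mathcal{T}$ is the spanning tree of edges traversed by a depth-first search; its edges are tree edges, the others are non-tree (back) edges, each connecting an ancestor–descendant pair and directed towards the root (tail = deeper endpoint). For a tree edge $e$, $\mathcal{T}_e$ is the subtree rooted at its deeper endpoint. A back edge $pq$ leaps over a tree edge $e$ if $p\in\mathcal{T}_e$, $q\notin\mathcal{T}_e$. $H(e)=\{e\}$ for a non-tree edge $e$, and $H(e)$ is the set of non-tree edges leaping over $e$ for a tree edge $e$. $\oplus$ is symmetric difference. -}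

module Defs where

open import Data.Nat using (ℕ; _<_; _≤_)
open import Data.Fin using (Fin)
open import Data.List using (List; []; _∷_; length)
open import Data.List.Membership.Propositional using (_∈_)
open import Data.Product using (Σ; ∃; _×_; _,_; proj₁; proj₂)
open import Data.Sum using (_⊎_)
open import Relation.Binary.PropositionalEquality using (_≡_; _≢_)
open import Relation.Nullary using (¬_)

-- A finite multigraph: vertices Fin n, edges Fin m, each edge has an
-- (unordered) pair of endpoints given by 'ends' (parallel edges allowed).
record Multigraph : Set where
  field
    n    : ℕ
    m    : ℕ
    ends : Fin m → Fin n × Fin n

open Multigraph public

Vtx : Multigraph → Set
Vtx G = Fin (n G)

Edge : Multigraph → Set
Edge G = Fin (m G)

Joins : (G : Multigraph) → Edge G → Vtx G → Vtx G → Set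
Joins G e x y = (ends G e ≡ (x , y)) ⊎ (ends G e ≡ (y , x))

data Reach (G : Multigraph) (S : List (Edge G)) : Vtx G → Vtx G → Set where
  here : ∀ {x} → Reach G S x x
  step : ∀ {x z y} (e : Edge G) → ¬ (e ∈ S) → Joins G e x z →
         Reach G S z y → Reach G S x y

ConnectedWithout : (G : Multigraph) → List (Edge G) → Set
ConnectedWithout G S = ∀ (x y : Vtx G) → Reach G S x y

Connected : Multigraph → Set
Connected G = ConnectedWithout G []

ThreeEdgeConnected : Multigraph → Set
ThreeEdgeConnected G =
  Connected G × (∀ (S : List (Edge G)) → length S ≤ 2 → ConnectedWithout G S)

ThreeEdgeCut : (G : Multigraph) → Edge G → Edge G → Edge G → Set
ThreeEdgeCut G e f g =
  e ≢ f × f ≢ g × e ≢ g × ¬ ConnectedWithout G (e ∷ f ∷ g ∷ [])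

-- A rooted spanning tree given by parent pointers: every non-root vertex v
-- has a parent par v and a parent edge pe v joining v and par v; the depth
-- strictly decreases towards the parent (so all parent chains end at root).
record RootedSpanningTree (G : Multigraph) : Set where
  field
    root      : Vtx G
    par       : Vtx G → Vtx G
    pe        : Vtx G → Edge G
    depth     : Vtx G → ℕ
    pe-joins  : ∀ v → v ≢ root → Joins G (pe v) v (par v)
    depth-dec : ∀ v → v ≢ root → depth (par v) < depth v

module _ {G : Multigraph} (T : RootedSpanningTree G) where
  open RootedSpanningTree T

  -- AncOf u w : w is an ancestor of u (or u itself) in T
  data AncOf : Vtx G → Vtx G → Set where
    self : ∀ {u} → AncOf u u
    up   : ∀ {u w} → u ≢ root → AncOf (par u) w → AncOf u w

  IsTreeEdge : Edge G → Set
  IsTreeEdge e = Σ (Vtx G) λ v → v ≢ root × pe v ≡ e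

  NonTreeEdge : Edge G → Set
  NonTreeEdge e = ¬ IsTreeEdge e

  InSubtree : Vtx G → Vtx G → Set
  InSubtree v p = AncOf p v

-- A DFS tree: a rooted spanning tree in which every non-tree edge connects
-- an ancestor–descendant pair (a normal / Trémaux tree).
record DFSTree (G : Multigraph) : Set where
  field
    tree    : RootedSpanningTree G
    backAnc : ∀ (b : Edge G) → NonTreeEdge tree b →
              AncOf tree (proj₁ (ends G b)) (proj₂ (ends G b))
              ⊎ AncOf tree (proj₂ (ends G b)) (proj₁ (ends G b))

module _ {G : Multigraph} (D : DFSTree G) where
  open DFSTree D
  open RootedSpanningTree tree

  -- the non-tree (back) edge b leaps over the tree edge e = pe v
  -- (v the deeper endpoint of e): tail p ∈ T_v, head q ∉ T_v,
  -- where q is an ancestor of p.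
  LeapsOver : Edge G → Vtx G → Set
  LeapsOver b v = Σ (Vtx G) λ p → Σ (Vtx G) λ q →
    Joins G b p q × AncOf tree p q ×
    InSubtree tree v p × ¬ InSubtree tree v q

  InH : Edge G → Edge G → Set
  InH e b =
    (NonTreeEdge tree e × b ≡ e)
    ⊎ (Σ (Vtx G) λ v → v ≢ root × pe v ≡ e ×
         NonTreeEdge tree b × LeapsOver b v)

  InHXor : Edge G → Edge G → Edge G → Set
  InHXor e f b = (InH e b × ¬ InH f b) ⊎ (¬ InH e b × InH f b)

  HashIsXor : Edge G → Edge G → Edge G → Set
  HashIsXor h e f = ∀ (b : Edge G) → (InH h b → InHXor e f b) × (InHXor e f b → InH h b)

-- Work with vertex 2-colourings F : V → Bool and their coboundaries δ F, the
-- edge sets crossing the colouring.  The indicator of the subtree below a tree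
-- edge c has coboundary {c} ⊕ H(c), and for a non-tree edge c the set {c} ⊕ H(c)
-- is empty; so {c} ⊕ H(c) is always a coboundary.  A 3-edge-cut {e,f,g} is the
-- coboundary of the side of the cut, hence H(e) ⊕ H(f) ⊕ H(g) is a coboundary
-- too.  It contains no tree edge, so the colouring is constant along the
-- spanning tree and the coboundary is empty.  Uniqueness: if H(h) = H(g) then
-- {h} ⊕ {g} is a coboundary, which 3-edge-connectivity forbids unless h = g.
module Submission where

open import Defs
open import Data.Product using (_×_; Σ; ∃₂; _,_; proj₁; proj₂)
open import Relation.Binary.PropositionalEquality
  using (_≡_; _≢_; refl; sym; trans; cong; cong₂; subst; module ≡-Reasoning)

open import Algebra.Bundles using (CommutativeRing)
open import Data.Bool using (Bool; true; false; _xor_)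
open import Data.Bool.Properties
  using (xor-assoc; xor-comm; xor-same; xor-identityʳ; ¬-not; not-¬; xor-∧-commutativeRing)
  renaming (_≟_ to _≟ᵇ_)
open import Data.Fin using (Fin; zero; suc)
open import Data.Fin.Properties using (_≟_; any?; all?; ¬∀⟶∃¬)
open import Data.List using (List; []; _∷_; length)
open import Data.List.Membership.Propositional using (_∉_)
open import Data.List.Relation.Binary.Subset.Propositional using (_⊆_)
open import Data.List.Relation.Unary.Any using (here; there)
open import Data.Nat using (zero; suc; _<_; _≤_; s≤s; z≤n)
open import Data.Nat.Induction using (<-wellFounded)
open import Data.Nat.Properties using (≤-refl; ≤-trans; <⇒≤; <-irrefl; <-asym; ≤-<-trans)
open import Data.Product.Properties using (≡-dec)
open import Data.Sum using (_⊎_; inj₁; inj₂)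
open import Function.Bundles using (_⇔_; mk⇔; module Equivalence)
open import Induction.WellFounded using (Acc; acc)
open import Relation.Nullary using (¬_; Dec; yes; no; does)
open import Relation.Nullary.Decidable
  using (_×-dec_; _⊎-dec_; ¬?; map′; dec-true; dec-false; decidable-stable; does-⇔; ¬¬-excluded-middle)
open import Relation.Nullary.Negation using (¬¬-map; contradiction)
open import Algebra.Properties.CommutativeSemigroup
  (CommutativeRing.+-commutativeSemigroup xor-∧-commutativeRing) using (interchange)

open ≡-Reasoning

xor-cancelˡ : ∀ x y → x xor (x xor y) ≡ y
xor-cancelˡ x y = trans (sym (xor-assoc x x y)) (cong (_xor y) (xor-same x))

xor-cancelʳ : ∀ x y → (x xor y) xor y ≡ x
xor-cancelʳ x y = begin
  (x xor y) xor y   ≡⟨ xor-assoc x y y ⟩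
  x xor (y xor y)   ≡⟨ cong (x xor_) (xor-same y) ⟩
  x xor false       ≡⟨ xor-identityʳ x ⟩
  x                 ∎

xor≡false⇒≡ : ∀ {x y} → x xor y ≡ false → x ≡ y
xor≡false⇒≡ {x} {y} x⊕y≡false = begin
  x                 ≡⟨ sym (xor-identityʳ x) ⟩
  x xor false       ≡⟨ cong (x xor_) (sym x⊕y≡false) ⟩
  x xor (x xor y)   ≡⟨ xor-cancelˡ x y ⟩
  y                 ∎

module _ {A B : Set} where

  does-xor : (a? : Dec A) (b? : Dec B) →
             does a? xor does b? ≡ does ((a? ×-dec ¬? b?) ⊎-dec (¬? a? ×-dec b?))
  does-xor (yes _) (yes _) = refl
  does-xor (yes _) (no _)  = refl
  does-xor (no _)  (yes _) = refl
  does-xor (no _)  (no _)  = refl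

  does-⊎-disjoint : ¬ (A × B) → (a? : Dec A) (b? : Dec B) →
                    does (a? ⊎-dec b?) ≡ does a? xor does b?
  does-⊎-disjoint ¬ab (yes a) (yes b) = contradiction (a , b) ¬ab
  does-⊎-disjoint ¬ab (yes _) (no _)  = refl
  does-⊎-disjoint ¬ab (no _)  (yes _) = refl
  does-⊎-disjoint ¬ab (no _)  (no _)  = refl

  does-≡⇒⇔ : (a? : Dec A) (b? : Dec B) → does a? ≡ does b? → A ⇔ B
  does-≡⇒⇔ (yes a)  (yes b)  _ = mk⇔ (λ _ → b) (λ _ → a)
  does-≡⇒⇔ (no ¬a) (no ¬b) _ = mk⇔ (λ a → contradiction a ¬a) (λ b → contradiction b ¬b)
  does-≡⇒⇔ (yes _)  (no _)  ()
  does-≡⇒⇔ (no _)  (yes _)  ()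

¬¬-∀-Fin : ∀ {k} {P : Fin k → Set} → (∀ i → ¬ ¬ P i) → ¬ ¬ (∀ i → P i)
¬¬-∀-Fin {zero} _ ¬all = ¬all λ ()
¬¬-∀-Fin {suc _} ¬¬P ¬all =
  ¬¬P zero λ P₀ → ¬¬-∀-Fin (λ i → ¬¬P (suc i)) λ Pₛ →
    ¬all λ { zero → P₀ ; (suc i) → Pₛ i }

module Coboundary (G : Multigraph) where

  δ : (Vtx G → Bool) → Edge G → Bool
  δ F c = F (proj₁ (ends G c)) xor F (proj₂ (ends G c))

  infixr 7 _⊻_
  _⊻_ : (Vtx G → Bool) → (Vtx G → Bool) → Vtx G → Bool
  (F ⊻ F′) z = F z xor F′ z

  VanishesOff : (Edge G → Bool) → List (Edge G) → Set
  VanishesOff φ S = ∀ c → c ∉ S → φ c ≡ false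

  VanishesOff-⊆ : ∀ {φ S S′} → S ⊆ S′ → VanishesOff φ S → VanishesOff φ S′
  VanishesOff-⊆ S⊆S′ vanish c c∉S′ = vanish c λ c∈S → c∉S′ (S⊆S′ c∈S)

  δ-joins : ∀ F {c x y} → Joins G c x y → F x xor F y ≡ δ F c
  δ-joins F (inj₁ eq) rewrite eq = refl
  δ-joins F {x = x} {y} (inj₂ eq) rewrite eq = xor-comm (F x) (F y)

  δ-cong : ∀ {F F′} → (∀ z → F z ≡ F′ z) → ∀ c → δ F c ≡ δ F′ c
  δ-cong F≗F′ c rewrite F≗F′ (proj₁ (ends G c)) | F≗F′ (proj₂ (ends G c)) = refl

  δ-⊻ : ∀ F F′ c → δ (F ⊻ F′) c ≡ δ F c xor δ F′ c
  δ-⊻ F F′ c = interchange (F (proj₁ (ends G c))) (F′ (proj₁ (ends G c)))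
                            (F (proj₂ (ends G c))) (F′ (proj₂ (ends G c)))

  Reach-snoc : ∀ {S x z y c} → Reach G S x z → c ∉ S → Joins G c z y → Reach G S x y
  Reach-snoc here            c∉S j = step _ c∉S j here
  Reach-snoc (step c′ c′∉S j′ r) c∉S j = step c′ c′∉S j′ (Reach-snoc r c∉S j)

  Reach-respects : ∀ {F S x y} → VanishesOff (δ F) S → Reach G S x y → F x ≡ F y
  Reach-respects vanish here = refl
  Reach-respects {F} vanish (step c c∉S j r) =
    trans (xor≡false⇒≡ (trans (δ-joins F j) (vanish c c∉S))) (Reach-respects vanish r)

  δ-vanishes : ∀ {F S} → ConnectedWithout G S → VanishesOff (δ F) S → ∀ c → δ F c ≡ false
  δ-vanishes {F} conn vanish c =
    trans (cong (_xor F (proj₂ (ends G c))) (Reach-respects {F} vanish (conn _ _)))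
          (xor-same (F (proj₂ (ends G c))))

  Separating : List (Edge G) → (Vtx G → Bool) → Set
  Separating S s = VanishesOff (δ s) S × ∃₂ λ x y → s x ≢ s y

  -- Without a decision procedure for Reach the side of the cut exists only
  -- under a double negation; this is harmless for Boolean goals, which are stable.
  separating-colouring : ∀ {S} → ¬ ConnectedWithout G S → ¬ ¬ Σ (Vtx G → Bool) (Separating S)
  separating-colouring {S} disconnected =
    ¬¬-map colour (¬¬-∀-Fin λ x → ¬¬-∀-Fin λ y → ¬¬-excluded-middle)
    where
    colour : (∀ x y → Dec (Reach G S x y)) → Σ (Vtx G → Bool) (Separating S)
    colour reach? with ¬∀⟶∃¬ (n G) _ (λ x → all? (reach? x)) disconnected
    ... | x₀ , ¬x₀↝all with ¬∀⟶∃¬ (n G) _ (reach? x₀) ¬x₀↝all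
    ... | y₀ , ¬x₀↝y₀ = s , vanish , x₀ , y₀ , s-x₀≢s-y₀
      where
      s : Vtx G → Bool
      s z = does (reach? x₀ z)

      s-x₀≢s-y₀ : s x₀ ≢ s y₀
      s-x₀≢s-y₀ eq =
        not-¬ (dec-true (reach? x₀ x₀) here) (trans eq (dec-false (reach? x₀ y₀) ¬x₀↝y₀))

      vanish : VanishesOff (δ s) S
      vanish c c∉S = agree (reach? x₀ (proj₁ (ends G c))) (reach? x₀ (proj₂ (ends G c)))
        where
        agree : (a? : Dec (Reach G S x₀ (proj₁ (ends G c))))
                (b? : Dec (Reach G S x₀ (proj₂ (ends G c)))) → does a? xor does b? ≡ false
        agree (yes _) (yes _) = refl
        agree (yes r) (no ¬r) = contradiction (Reach-snoc r c∉S (inj₁ refl)) ¬r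
        agree (no ¬r) (yes r) = contradiction (Reach-snoc r c∉S (inj₂ refl)) ¬r
        agree (no _)  (no _)  = refl

  module _ (connected₂ : ∀ S → length S ≤ 2 → ConnectedWithout G S)
           (s : Vtx G → Bool) {x y : Vtx G} (s-x≢s-y : s x ≢ s y) where

    crossing : ∀ {c c₁ c₂} → VanishesOff (δ s) (c ∷ c₁ ∷ c₂ ∷ []) → δ s c ≡ true
    crossing {c} {c₁} {c₂} vanish = ¬-not λ δc≡false →
      s-x≢s-y (Reach-respects (vanish-off-pair δc≡false)
                              (connected₂ (c₁ ∷ c₂ ∷ []) (s≤s (s≤s z≤n)) x y))
      where
      vanish-off-pair : δ s c ≡ false → VanishesOff (δ s) (c₁ ∷ c₂ ∷ [])
      vanish-off-pair δc≡false c′ c′∉ with c′ ≟ c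
      ... | yes refl = δc≡false
      ... | no c′≢c  = vanish c′ λ { (here c′≡c) → c′≢c c′≡c
                                    ; (there c′∈) → c′∉ c′∈ }

    δ-three-cut : ∀ {e f g} → e ≢ f → f ≢ g → e ≢ g → VanishesOff (δ s) (e ∷ f ∷ g ∷ []) →
                  ∀ c → δ s c ≡ does (c ≟ e) xor (does (c ≟ f) xor does (c ≟ g))
    δ-three-cut {e} {f} {g} e≢f f≢g e≢g vanish c with c ≟ e | c ≟ f | c ≟ g
    ... | yes refl | yes refl | _        = contradiction refl e≢f
    ... | yes refl | no _     | yes refl = contradiction refl e≢g
    ... | no _     | yes refl | yes refl = contradiction refl f≢g
    ... | yes refl | no _     | no _     = crossing vanish
    ... | no _     | yes refl | no _     = crossing (VanishesOff-⊆ swap₁₂ vanish)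
      where
      swap₁₂ : e ∷ f ∷ g ∷ [] ⊆ f ∷ e ∷ g ∷ []
      swap₁₂ (here p)         = there (here p)
      swap₁₂ (there (here p)) = here p
      swap₁₂ (there (there p)) = there (there p)
    ... | no _     | no _     | yes refl = crossing (VanishesOff-⊆ rotate vanish)
      where
      rotate : e ∷ f ∷ g ∷ [] ⊆ g ∷ e ∷ f ∷ []
      rotate (here p)                 = there (here p)
      rotate (there (here p))         = there (there (here p))
      rotate (there (there (here p))) = here p
    ... | no c≢e   | no c≢f   | no c≢g   = vanish c λ
      { (here p) → c≢e p ; (there (here p)) → c≢f p ; (there (there (here p))) → c≢g p }

module DFSHash {G : Multigraph} (D : DFSTree G) where
  open DFSTree D
  open RootedSpanningTree tree
  open Coboundary G

  AncOf-depth : ∀ {u w} → AncOf tree u w → depth w ≤ depth u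
  AncOf-depth self          = ≤-refl
  AncOf-depth (up u≢root a) = ≤-trans (AncOf-depth a) (<⇒≤ (depth-dec _ u≢root))

  AncOf-trans : ∀ {u w x} → AncOf tree u w → AncOf tree w x → AncOf tree u x
  AncOf-trans self          b = b
  AncOf-trans (up u≢root a) b = up u≢root (AncOf-trans a b)

  ¬AncOf-par : ∀ {v} → v ≢ root → ¬ AncOf tree (par v) v
  ¬AncOf-par {v} v≢root a = <-irrefl refl (≤-<-trans (AncOf-depth a) (depth-dec v v≢root))

  AncOf-root : ∀ z → AncOf tree z root
  AncOf-root z = go z (<-wellFounded (depth z))
    where
    go : ∀ z → Acc _<_ (depth z) → AncOf tree z root
    go z (acc rs) with z ≟ root
    ... | yes refl   = self
    ... | no z≢root = up z≢root (go (par z) (rs (depth-dec z z≢root)))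

  AncOf? : ∀ u w → Dec (AncOf tree u w)
  AncOf? u w = go (AncOf-root u)
    where
    go : ∀ {u} → AncOf tree u root → Dec (AncOf tree u w)
    go {u} _ with u ≟ w
    go _             | yes refl = yes self
    go self          | no u≢w   = no λ { self → u≢w refl ; (up root≢root _) → root≢root refl }
    go (up u≢root a) | no u≢w   =
      map′ (up u≢root) (λ { self → contradiction refl u≢w ; (up _ b) → b }) (go a)

  pe-injective : ∀ {u v} → u ≢ root → v ≢ root → pe u ≡ pe v → u ≡ v
  pe-injective {u} {v} u≢root v≢root pu≡pv = from-ends (pe-joins u u≢root) (pe-joins v v≢root)
    where
    same : ∀ {p q} → ends G (pe u) ≡ p → ends G (pe v) ≡ q → p ≡ q
    same eu ev = trans (sym eu) (trans (cong (ends G) pu≡pv) ev)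

    ¬2-cycle : u ≡ par v → par u ≢ v
    ¬2-cycle u≡pv pu≡v = <-asym (subst (λ x → depth x < depth v) (sym u≡pv) (depth-dec v v≢root))
                                (subst (λ x → depth x < depth u) pu≡v (depth-dec u u≢root))

    from-ends : Joins G (pe u) u (par u) → Joins G (pe v) v (par v) → u ≡ v
    from-ends (inj₁ eu) (inj₁ ev) = cong proj₁ (same eu ev)
    from-ends (inj₂ eu) (inj₂ ev) = cong proj₂ (same eu ev)
    from-ends (inj₁ eu) (inj₂ ev) =
      contradiction (cong proj₂ (same eu ev)) (¬2-cycle (cong proj₁ (same eu ev)))
    from-ends (inj₂ eu) (inj₁ ev) =
      contradiction (cong proj₁ (same eu ev)) (¬2-cycle (cong proj₂ (same eu ev)))

  δ-vanishes-from-tree-edges : ∀ {F} → (∀ z → z ≢ root → δ F (pe z) ≡ false) →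
                               ∀ c → δ F c ≡ false
  δ-vanishes-from-tree-edges {F} on-tree c =
    trans (cong (_xor F b) (trans (F-root a) (sym (F-root b)))) (xor-same (F b))
    where
    a b : Vtx G
    a = proj₁ (ends G c)
    b = proj₂ (ends G c)

    F-AncOf : ∀ {u w} → AncOf tree u w → F u ≡ F w
    F-AncOf self = refl
    F-AncOf (up {u} u≢root anc) =
      trans (xor≡false⇒≡ (trans (δ-joins F (pe-joins u u≢root)) (on-tree u u≢root))) (F-AncOf anc)

    F-root : ∀ z → F z ≡ F root
    F-root z = F-AncOf (AncOf-root z)

  Joins? : ∀ c x y → Dec (Joins G c x y)
  Joins? c x y = ≡-dec _≟_ _≟_ (ends G c) (x , y) ⊎-dec ≡-dec _≟_ _≟_ (ends G c) (y , x)

  IsTreeEdge? : ∀ c → Dec (IsTreeEdge tree c)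
  IsTreeEdge? c = any? λ v → ¬? (v ≟ root) ×-dec pe v ≟ c

  LeapsOver? : ∀ b v → Dec (LeapsOver D b v)
  LeapsOver? b v = any? λ p → any? λ q →
    Joins? b p q ×-dec AncOf? p q ×-dec AncOf? p v ×-dec ¬? (AncOf? q v)

  InH? : ∀ c b → Dec (InH D c b)
  InH? c b = (¬? (IsTreeEdge? c) ×-dec b ≟ c) ⊎-dec
    any? (λ v → ¬? (v ≟ root) ×-dec pe v ≟ c ×-dec ¬? (IsTreeEdge? b) ×-dec LeapsOver? b v)

  inH : Edge G → Edge G → Bool
  inH c b = does (InH? c b)

  InHXor? : ∀ e f b → Dec (InHXor D e f b)
  InHXor? e f b = (InH? e b ×-dec ¬? (InH? f b)) ⊎-dec (¬? (InH? e b) ×-dec InH? f b)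

  HashIsXor⇒xor : ∀ {h e f} → HashIsXor D h e f → ∀ b → inH h b ≡ inH e b xor inH f b
  HashIsXor⇒xor {h} {e} {f} hash b =
    trans (does-⇔ (mk⇔ (proj₁ (hash b)) (proj₂ (hash b))) (InH? h b) (InHXor? e f b))
          (sym (does-xor (InH? e b) (InH? f b)))

  xor⇒HashIsXor : ∀ {h e f} → (∀ b → inH h b ≡ inH e b xor inH f b) → HashIsXor D h e f
  xor⇒HashIsXor {h} {e} {f} hash b = to , from
    where
    open Equivalence (does-≡⇒⇔ (InH? h b) (InHXor? e f b)
                                (trans (hash b) (does-xor (InH? e b) (InH? f b))))

  InH-nontree : ∀ {c′ c} → NonTreeEdge tree c′ → InH D c′ c ⇔ c ≡ c′
  InH-nontree nt = mk⇔
    (λ { (inj₁ (_ , c≡c′)) → c≡c′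
       ; (inj₂ (v , v≢root , pv≡c′ , _)) → contradiction (v , v≢root , pv≡c′) nt })
    (λ c≡c′ → inj₁ (nt , c≡c′))

  InH-pe : ∀ {v c} → v ≢ root → NonTreeEdge tree c → InH D (pe v) c ⇔ LeapsOver D c v
  InH-pe v≢root nt = mk⇔
    (λ { (inj₁ (nt-pv , _)) → contradiction (_ , v≢root , refl) nt-pv
       ; (inj₂ (v′ , v′≢root , pv′≡pv , _ , leaps)) →
           subst (LeapsOver D _) (pe-injective v′≢root v≢root pv′≡pv) leaps })
    (λ leaps → inj₂ (_ , v≢root , refl , nt , leaps))

  inH-tree-edge : ∀ {c′ z} → z ≢ root → inH c′ (pe z) ≡ false
  inH-tree-edge {c′} {z} z≢root = dec-false (InH? c′ (pe z)) λ
    { (inj₁ (nt , pz≡c′))          → nt (_ , z≢root , pz≡c′)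
    ; (inj₂ (_ , _ , _ , nt , _)) → nt (_ , z≢root , refl) }

  CrossesSubtree : Vtx G → Edge G → Set
  CrossesSubtree v c =
    (InSubtree tree v a × ¬ InSubtree tree v b) ⊎ (¬ InSubtree tree v a × InSubtree tree v b)
    where
    a b : Vtx G
    a = proj₁ (ends G c)
    b = proj₂ (ends G c)

  -- The DFS property enters only here: an edge joining an ancestor–descendant
  -- pair with exactly one end in T_v has that end as its tail.
  LeapsOver⇔CrossesSubtree : ∀ {c v} → NonTreeEdge tree c → LeapsOver D c v ⇔ CrossesSubtree v c
  LeapsOver⇔CrossesSubtree {c} {v} nt = mk⇔ to from
    where
    a b : Vtx G
    a = proj₁ (ends G c)
    b = proj₂ (ends G c)

    to : LeapsOver D c v → CrossesSubtree v c
    to (_ , _ , inj₁ eq , _ , p∈ , q∉) =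
      inj₁ ( subst (InSubtree tree v) (sym (cong proj₁ eq)) p∈
           , λ b∈ → q∉ (subst (InSubtree tree v) (cong proj₂ eq) b∈))
    to (_ , _ , inj₂ eq , _ , p∈ , q∉) =
      inj₂ ( (λ a∈ → q∉ (subst (InSubtree tree v) (cong proj₁ eq) a∈))
           , subst (InSubtree tree v) (sym (cong proj₂ eq)) p∈)

    from : CrossesSubtree v c → LeapsOver D c v
    from (inj₁ (a∈ , b∉)) with backAnc c nt
    ... | inj₁ b-above-a = a , b , inj₁ refl , b-above-a , a∈ , b∉
    ... | inj₂ a-above-b = contradiction (AncOf-trans a-above-b a∈) b∉
    from (inj₂ (a∉ , b∈)) with backAnc c nt
    ... | inj₁ b-above-a = contradiction (AncOf-trans b-above-a b∈) a∉
    ... | inj₂ a-above-b = b , a , inj₂ refl , a-above-b , b∈ , a∉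

  subtree : Vtx G → Vtx G → Bool
  subtree v z = does (AncOf? z v)

  subtree-step : ∀ {v w} → w ≢ root → InSubtree tree v w ⇔ (w ≡ v ⊎ InSubtree tree v (par w))
  subtree-step w≢root = mk⇔ (λ { self → inj₁ refl ; (up _ a) → inj₂ a })
                            (λ { (inj₁ refl) → self ; (inj₂ a) → up w≢root a })

  δ-subtree-tree-edge : ∀ {v w} → w ≢ root → δ (subtree v) (pe w) ≡ does (w ≟ v)
  δ-subtree-tree-edge {v} {w} w≢root = begin
    δ (subtree v) (pe w)
      ≡⟨ δ-joins (subtree v) (pe-joins w w≢root) ⟨
    subtree v w xor subtree v (par w)
      ≡⟨ cong (_xor subtree v (par w)) w-step ⟩
    (does (w ≟ v) xor subtree v (par w)) xor subtree v (par w)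
      ≡⟨ xor-cancelʳ (does (w ≟ v)) (subtree v (par w)) ⟩
    does (w ≟ v)
      ∎
    where
    w-step : subtree v w ≡ does (w ≟ v) xor subtree v (par w)
    w-step = trans (does-⇔ (subtree-step w≢root) (AncOf? w v) ((w ≟ v) ⊎-dec AncOf? (par w) v))
                   (does-⊎-disjoint (λ { (refl , a) → ¬AncOf-par w≢root a }) (w ≟ v) (AncOf? (par w) v))

  δ-subtree-nontree : ∀ {v c} → NonTreeEdge tree c → δ (subtree v) c ≡ does (LeapsOver? c v)
  δ-subtree-nontree {v} {c} nt =
    trans (does-xor a∈? b∈?)
          (sym (does-⇔ (LeapsOver⇔CrossesSubtree nt) (LeapsOver? c v)
                       ((a∈? ×-dec ¬? b∈?) ⊎-dec (¬? a∈? ×-dec b∈?))))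
    where
    a∈? : Dec (InSubtree tree v (proj₁ (ends G c)))
    a∈? = AncOf? (proj₁ (ends G c)) v
    b∈? : Dec (InSubtree tree v (proj₂ (ends G c)))
    b∈? = AncOf? (proj₂ (ends G c)) v

  δ-subtree : ∀ {v} → v ≢ root → ∀ c → δ (subtree v) c ≡ does (c ≟ pe v) xor inH (pe v) c
  δ-subtree {v} v≢root c = by-kind (IsTreeEdge? c)
    where
    by-kind : Dec (IsTreeEdge tree c) → δ (subtree v) c ≡ does (c ≟ pe v) xor inH (pe v) c
    by-kind (yes (w , w≢root , refl)) = begin
      δ (subtree v) (pe w)
        ≡⟨ δ-subtree-tree-edge w≢root ⟩
      does (w ≟ v)
        ≡⟨ does-⇔ (mk⇔ (cong pe) (pe-injective w≢root v≢root)) (w ≟ v) (pe w ≟ pe v) ⟩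
      does (pe w ≟ pe v)
        ≡⟨ xor-identityʳ _ ⟨
      does (pe w ≟ pe v) xor false
        ≡⟨ cong (does (pe w ≟ pe v) xor_) (inH-tree-edge w≢root) ⟨
      does (pe w ≟ pe v) xor inH (pe v) (pe w)
        ∎
    by-kind (no nt) = begin
      δ (subtree v) c                   ≡⟨ δ-subtree-nontree nt ⟩
      does (LeapsOver? c v)             ≡⟨ does-⇔ (InH-pe v≢root nt) (InH? (pe v) c) (LeapsOver? c v) ⟨
      inH (pe v) c                      ≡⟨ cong (_xor inH (pe v) c) c≢pv ⟨
      does (c ≟ pe v) xor inH (pe v) c  ∎
      where
      c≢pv : does (c ≟ pe v) ≡ false
      c≢pv = dec-false (c ≟ pe v) λ c≡pv → nt (v , v≢root , sym c≡pv)

  BelowEdge : Edge G → Vtx G → Set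
  BelowEdge c z = Σ (Vtx G) λ v → v ≢ root × pe v ≡ c × InSubtree tree v z

  BelowEdge? : ∀ c z → Dec (BelowEdge c z)
  BelowEdge? c z = any? λ v → ¬? (v ≟ root) ×-dec pe v ≟ c ×-dec AncOf? z v

  BelowEdge-pe : ∀ {v z} → v ≢ root → BelowEdge (pe v) z ⇔ InSubtree tree v z
  BelowEdge-pe v≢root = mk⇔
    (λ { (v′ , v′≢root , pv′≡pv , z∈) →
           subst (AncOf tree _) (pe-injective v′≢root v≢root pv′≡pv) z∈ })
    (λ z∈ → _ , v≢root , refl , z∈)

  ¬BelowEdge-nontree : ∀ {c z} → NonTreeEdge tree c → ¬ BelowEdge c z
  ¬BelowEdge-nontree nt (v , v≢root , pv≡c , _) = nt (v , v≢root , pv≡c)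

  below : Edge G → Vtx G → Bool
  below c z = does (BelowEdge? c z)

  δ-below : ∀ c′ c → δ (below c′) c ≡ does (c ≟ c′) xor inH c′ c
  δ-below c′ c = by-kind (IsTreeEdge? c′)
    where
    by-kind : Dec (IsTreeEdge tree c′) → δ (below c′) c ≡ does (c ≟ c′) xor inH c′ c
    by-kind (yes (v , v≢root , refl)) =
      trans (δ-cong (λ z → does-⇔ (BelowEdge-pe v≢root) (BelowEdge? (pe v) z) (AncOf? z v)) c)
            (δ-subtree v≢root c)
    by-kind (no nt) = begin
      δ (below c′) c
        ≡⟨ δ-cong (λ z → dec-false (BelowEdge? c′ z) (¬BelowEdge-nontree nt)) c ⟩
      false
        ≡⟨ xor-same (does (c ≟ c′)) ⟨
      does (c ≟ c′) xor does (c ≟ c′)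
        ≡⟨ cong (does (c ≟ c′) xor_) (does-⇔ (InH-nontree nt) (InH? c′ c) (c ≟ c′)) ⟨
      does (c ≟ c′) xor inH c′ c
        ∎

  δ-below₂ : ∀ h g c →
             δ (below h ⊻ below g) c ≡ (does (c ≟ h) xor does (c ≟ g)) xor (inH h c xor inH g c)
  δ-below₂ h g c = begin
    δ (below h ⊻ below g) c
      ≡⟨ δ-⊻ (below h) (below g) c ⟩
    δ (below h) c xor δ (below g) c
      ≡⟨ cong₂ _xor_ (δ-below h c) (δ-below g c) ⟩
    (does (c ≟ h) xor inH h c) xor (does (c ≟ g) xor inH g c)
      ≡⟨ interchange (does (c ≟ h)) (inH h c) (does (c ≟ g)) (inH g c) ⟩
    (does (c ≟ h) xor does (c ≟ g)) xor (inH h c xor inH g c)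
      ∎

  δ-below₃ : ∀ e f g c → δ (below e ⊻ below f ⊻ below g) c ≡
             (does (c ≟ e) xor (does (c ≟ f) xor does (c ≟ g))) xor (inH e c xor (inH f c xor inH g c))
  δ-below₃ e f g c = begin
    δ (below e ⊻ below f ⊻ below g) c
      ≡⟨ δ-⊻ (below e) (below f ⊻ below g) c ⟩
    δ (below e) c xor δ (below f ⊻ below g) c
      ≡⟨ cong₂ _xor_ (δ-below e c) (δ-below₂ f g c) ⟩
    (does (c ≟ e) xor inH e c) xor ((does (c ≟ f) xor does (c ≟ g)) xor (inH f c xor inH g c))
      ≡⟨ interchange (does (c ≟ e)) (inH e c) (does (c ≟ f) xor does (c ≟ g)) (inH f c xor inH g c) ⟩
    (does (c ≟ e) xor (does (c ≟ f) xor does (c ≟ g))) xor (inH e c xor (inH f c xor inH g c))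
      ∎

  hash-injective : (∀ S → length S ≤ 2 → ConnectedWithout G S) →
                   ∀ {h g} → (∀ b → inH h b ≡ inH g b) → h ≡ g
  hash-injective connected₂ {h} {g} same-hash with h ≟ g
  ... | yes h≡g = h≡g
  ... | no h≢g  = contradiction δψ-h≡false (not-¬ δψ-h≡true)
    where
    δψ : ∀ c → δ (below h ⊻ below g) c ≡ does (c ≟ h) xor does (c ≟ g)
    δψ c = begin
      δ (below h ⊻ below g) c                ≡⟨ δ-below₂ h g c ⟩
      [h,g] xor (inH h c xor inH g c)        ≡⟨ cong (λ i → [h,g] xor (i xor inH g c)) (same-hash c) ⟩
      [h,g] xor (inH g c xor inH g c)        ≡⟨ cong ([h,g] xor_) (xor-same (inH g c)) ⟩
      [h,g] xor false                        ≡⟨ xor-identityʳ [h,g] ⟩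
      [h,g]                                  ∎
      where
      [h,g] : Bool
      [h,g] = does (c ≟ h) xor does (c ≟ g)

    vanish : VanishesOff (δ (below h ⊻ below g)) (h ∷ g ∷ [])
    vanish c c∉ = trans (δψ c) (cong₂ _xor_ (dec-false (c ≟ h) (λ c≡h → c∉ (here c≡h)))
                                             (dec-false (c ≟ g) (λ c≡g → c∉ (there (here c≡g)))))

    δψ-h≡false : δ (below h ⊻ below g) h ≡ false
    δψ-h≡false = δ-vanishes {below h ⊻ below g} (connected₂ (h ∷ g ∷ []) (s≤s (s≤s z≤n))) vanish h

    δψ-h≡true : δ (below h ⊻ below g) h ≡ true
    δψ-h≡true = trans (δψ h) (cong₂ _xor_ (dec-true (h ≟ h) refl) (dec-false (h ≟ g) h≢g))

  hash-of-three-cut : ThreeEdgeConnected G → ∀ {e f g} → ThreeEdgeCut G e f g →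
                      ∀ b → inH g b ≡ inH e b xor inH f b
  hash-of-three-cut (_ , connected₂) {e} {f} {g} (e≢f , f≢g , e≢g , disconnected) b =
    decidable-stable (inH g b ≟ᵇ inH e b xor inH f b) (¬¬-map from-side (separating-colouring disconnected))
    where
    κ : Edge G → Bool
    κ c = inH e c xor (inH f c xor inH g c)

    κ-tree-edge : ∀ z → z ≢ root → κ (pe z) ≡ false
    κ-tree-edge z z≢root
      rewrite inH-tree-edge {e} z≢root | inH-tree-edge {f} z≢root | inH-tree-edge {g} z≢root = refl

    from-side : Σ (Vtx G → Bool) (Separating (e ∷ f ∷ g ∷ [])) → inH g b ≡ inH e b xor inH f b
    from-side (s , vanish , _ , _ , s-x≢s-y) =
      sym (xor≡false⇒≡ (trans (xor-assoc (inH e b) (inH f b) (inH g b)) κ-b≡false))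
      where
      δφ : ∀ c → δ (s ⊻ below e ⊻ below f ⊻ below g) c ≡ κ c
      δφ c = begin
        δ (s ⊻ below e ⊻ below f ⊻ below g) c
          ≡⟨ δ-⊻ s (below e ⊻ below f ⊻ below g) c ⟩
        δ s c xor δ (below e ⊻ below f ⊻ below g) c
          ≡⟨ cong₂ _xor_ (δ-three-cut connected₂ s s-x≢s-y e≢f f≢g e≢g vanish c)
                         (δ-below₃ e f g c) ⟩
        χ xor (χ xor κ c)
          ≡⟨ xor-cancelˡ χ (κ c) ⟩
        κ c
          ∎
        where
        χ : Bool
        χ = does (c ≟ e) xor (does (c ≟ f) xor does (c ≟ g))

      κ-b≡false : κ b ≡ false
      κ-b≡false = trans (sym (δφ b)) (δ-vanishes-from-tree-edges {s ⊻ below e ⊻ below f ⊻ below g}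
                                       (λ z z≢root → trans (δφ (pe z)) (κ-tree-edge z z≢root)) b)

lemma4p5 : (G : Multigraph) (D : DFSTree G) → ThreeEdgeConnected G →
           (e f g : Edge G) → ThreeEdgeCut G e f g →
           HashIsXor D g e f × (∀ (h : Edge G) → HashIsXor D h e f → h ≡ g)
lemma4p5 G D tec e f g cut = xor⇒HashIsXor hash-g , unique
  where
  open DFSHash D

  hash-g : ∀ b → inH g b ≡ inH e b xor inH f b
  hash-g = hash-of-three-cut tec cut

  unique : ∀ h → HashIsXor D h e f → h ≡ g
  unique h hash-h = hash-injective (proj₂ tec) λ b → trans (HashIsXor⇒xor hash-h b) (sym (hash-g b))
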